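{- Let $\Phi$ be a 3-CNF formula with $n$ variables and $m$ clauses and let $\pi$ be the permutation constructed from $\Phi$ as in the context. In any red-blue graph $G(\pi,\mathcal{S})$ ($\mathcal{S}$ a block sorting schedule of $\pi$) there are at most $m$ red edges joining pairs of the form $(p_i^j,q_i^j)$ or $(\bar p_i^j,\bar q_i^j)$ ($1\le i\le n$, $1\le j\le m$), at most one in each clause encoding. Furthermore, if there is a red edge between $p_i^j$ and $q_i^j$, then there is no red edge between $\bar p_i^k$ and $\bar q_i^k$ for any $1\le k\le m$, $k\ne j$.
   Context: Block sorting: for a permutation of a totally ordered finite set, a block is a maximal substring that is also a substring of the sorted sequence; a block move removes a block and reinserts it elsewhere; a block sorting schedule sorts the permutation by block moves. Blocks are joined at the step at which they first lie in a common block. The red-blue graph $G(\pi,\mathcal{S})$ has the blocks of $\pi$ as vertices; a blue edge joins adjacent blocks $a$ (immediately before) $b$ with $a>b$; a red edge joins blocks $a<b$ where $a$ precedes $b$ in $\pi$, $a,b$ are joined in $\mathcal{S}$ before either is moved, and every block positioned strictly between them in $\pi$ is moved before they are joined. Construction: $\Phi$ has variables $x_1,\dots,x_n$, clauses $\mathcal{C}^1,\dots,\mathcal{C}^m$, each $(z_a\vee z_b\vee z_c)$ with $a>b>c$, $z_i\in\{x_i,\bar x_i\}$. Symbols $p_i^j,\bar p_i^j,q_i^j,\bar q_i^j$; $\ell^j,r^j$ ($1\le j\le m+n$); $u_i,\upsilon_i$; $s$, ordered by $u_i<p_i^k<p_i^j<\bar p_i^k<\bar p_i^j<q_i^j<q_i^k<\bar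 q_i^j<\bar q_i^k<\upsilon_i<s$ ($1\le j<k\le m$), $\upsilon_{i-1}<u_i$, $s<\ell^k<r^k<\ell^j<r^j$ ($1\le j<k\le m+n$). Literal $x_i$ in clause $j$ has left symbol $p_i^j$, right symbol $q_i^j$; $\bar x_i$ has $\bar p_i^j,\bar q_i^j$. $\mathcal{C}^j$ is encoded as $\ell^j$, left symbols of $z_a,z_b,z_c$, right symbols of $z_a,z_b,z_c$, $r^j$. $\pi$ is $s$, the encodings of $\mathcal{C}^1,\dots,\mathcal{C}^m$, then $\ell^{m+i}u_i\upsilon_ir^{m+i}$ for $i=1,\dots,n$. -}

module Defs where

open import Data.Nat using (ℕ; zero; suc; _+_; _*_; _∸_; _<_; _≤_)
open import Data.Fin using (Fin; toℕ; _↑ˡ_; _↑ʳ_)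
open import Data.Bool using (Bool; true; false)
open import Data.List using (List; []; _∷_; _++_; [_]; concat; map; allFin)
open import Data.Vec using (Vec; lookup)
open import Data.Product using (Σ; ∃; _×_; _,_)
open import Data.Sum using (_⊎_)
open import Data.Empty using (⊥)
open import Relation.Nullary using (¬_)
open import Relation.Binary.PropositionalEquality using (_≡_; _≢_)
open import Data.List.Membership.Propositional using (_∈_)
open import Data.List.Relation.Binary.Subset.Propositional using (_⊆_)
open import Data.List.Relation.Unary.Linked using (Linked)

-- Block sorting, for sequences over a type A ordered by a strict order _≺_.
-- A "permutation" is a list of distinct elements; its sorted sequence is the
-- increasing arrangement of its elements.

module BlockSorting {A : Set} (_≺_ : A → A → Set) where

  Succ : List A → A → A → Set
  Succ σ a b = a ∈ σ × b ∈ σ × a ≺ b × (∀ c → c ∈ σ → a ≺ c → c ≺ b → ⊥)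

  -- σ = pre ++ w ++ post and w is a block of σ: a nonempty substring of the
  -- sorted sequence (consecutive entries are successors), maximal with this property.
  BlockAt : List A → List A → List A → List A → Set
  BlockAt σ pre w post =
    σ ≡ pre ++ w ++ post
    × w ≢ []
    × Linked (Succ σ) w
    × (∀ pre′ x y ws → pre ≡ pre′ ++ [ x ] → w ≡ y ∷ ws → ¬ Succ σ x y)
    × (∀ ws x y post′ → w ≡ ws ++ [ x ] → post ≡ y ∷ post′ → ¬ Succ σ x y)

  IsBlock : List A → List A → Set
  IsBlock σ w = Σ (List A) λ pre → Σ (List A) λ post → BlockAt σ pre w post

  BlockMove : List A → List A → List A → Set
  BlockMove σ w σ′ =
    Σ (List A) λ pre → Σ (List A) λ post → Σ (List A) λ L → Σ (List A) λ R →
      BlockAt σ pre w post × pre ++ post ≡ L ++ R × σ′ ≡ L ++ w ++ R × σ′ ≢ σ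

  -- A schedule is the list of its moves; each move records the moved block and
  -- the resulting sequence.  IsSchedule π S: S is a block sorting schedule of π.
  data IsSchedule : List A → List (List A × List A) → Set where
    done : ∀ {σ} → Linked _≺_ σ → IsSchedule σ []
    move : ∀ {σ w σ′ S} → BlockMove σ w σ′ → IsSchedule σ′ S →
           IsSchedule σ ((w , σ′) ∷ S)

  -- sequence after the first t moves (stays at the final sequence afterwards)
  stateAt : List A → List (List A × List A) → ℕ → List A
  stateAt σ S zero = σ
  stateAt σ [] (suc t) = σ
  stateAt σ ((w , σ′) ∷ S) (suc t) = stateAt σ′ S t

  -- the block moved at step t (steps are numbered 1,2,…; [] if no such step)
  movedBlock : List (List A × List A) → ℕ → List A
  movedBlock [] t = []
  movedBlock (m ∷ S) zero = []
  movedBlock ((w , σ′) ∷ S) (suc zero) = w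
  movedBlock (m ∷ S) (suc (suc t)) = movedBlock S (suc t)

  MovedAt : List (List A × List A) → List A → ℕ → Set
  MovedAt S X t = ∃ λ x → x ∈ X × x ∈ movedBlock S t

  Together : List A → List A → List A → Set
  Together σ X Y = ∃ λ Z → IsBlock σ Z × X ⊆ Z × Y ⊆ Z

  JoinedAt : List A → List (List A × List A) → List A → List A → ℕ → Set
  JoinedAt π S X Y J =
    Together (stateAt π S J) X Y × (∀ t → t < J → ¬ Together (stateAt π S t) X Y)

  RedEdge : List A → List (List A × List A) → List A → List A → Set
  RedEdge π S X Y =
    IsBlock π X × IsBlock π Y
    × (∀ x y → x ∈ X → y ∈ Y → x ≺ y)
    × Σ (List A) λ pre → Σ (List A) λ mid → Σ (List A) λ post →
        π ≡ pre ++ X ++ mid ++ Y ++ post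
        × Σ ℕ λ J → JoinedAt π S X Y J
          × (∀ t → t ≤ J → ¬ MovedAt S X t × ¬ MovedAt S Y t)
          × (∀ C a b → IsBlock π C → mid ≡ a ++ C ++ b → ∃ λ t → t ≤ J × MovedAt S C t)

  RedJoin : List A → List (List A × List A) → A → A → Set
  RedJoin π S x y = ∃ λ X → ∃ λ Y → x ∈ X × y ∈ Y × (RedEdge π S X Y ⊎ RedEdge π S Y X)

open BlockSorting public

-- 3-CNF formulas.  Variables x_1..x_n are Fin n (0-based), clauses C^1..C^m are Fin m.

record Literal (n : ℕ) : Set where
  constructor lit
  field
    var : Fin n
    pos : Bool      -- true: x_i, false: x̄_i

record Clause (n : ℕ) : Set where
  field
    za zb zc : Literal n
    a>b : toℕ (Literal.var zb) < toℕ (Literal.var za)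
    b>c : toℕ (Literal.var zc) < toℕ (Literal.var zb)

CNF3 : ℕ → ℕ → Set
CNF3 n m = Vec (Clause n) m

-- Symbols of the construction.  p i j = p_i^j, pb = p̄, q, qb = q̄,
-- ℓ J, r J for J : Fin (m + n), u i, υ i, s.

data Sym (n m : ℕ) : Set where
  p pb q qb : Fin n → Fin m → Sym n m
  ℓ r : Fin (m + n) → Sym n m
  u υ : Fin n → Sym n m
  s : Sym n m

-- the total order of the context, given by a rank into ℕ:
-- u_i < p_i^m < … < p_i^1 < p̄_i^m < … < p̄_i^1 < q_i^1 < … < q_i^m
--     < q̄_i^1 < … < q̄_i^m < υ_i < u_{i+1} < … < s
--     < ℓ^{m+n} < r^{m+n} < … < ℓ^1 < r^1
rank : ∀ {n m} → Sym n m → ℕ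
rank {n} {m} (u i)    = toℕ i * (4 * m + 2)
rank {n} {m} (p i j)  = toℕ i * (4 * m + 2) + 1 + (m ∸ suc (toℕ j))
rank {n} {m} (pb i j) = toℕ i * (4 * m + 2) + 1 + m + (m ∸ suc (toℕ j))
rank {n} {m} (q i j)  = toℕ i * (4 * m + 2) + 1 + 2 * m + toℕ j
rank {n} {m} (qb i j) = toℕ i * (4 * m + 2) + 1 + 3 * m + toℕ j
rank {n} {m} (υ i)    = toℕ i * (4 * m + 2) + 4 * m + 1
rank {n} {m} s        = n * (4 * m + 2)
rank {n} {m} (ℓ J)    = n * (4 * m + 2) + 1 + 2 * ((m + n) ∸ suc (toℕ J))
rank {n} {m} (r J)    = n * (4 * m + 2) + 2 + 2 * ((m + n) ∸ suc (toℕ J))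

_≺ˢ_ : ∀ {n m} → Sym n m → Sym n m → Set
x ≺ˢ y = rank x < rank y

leftSym : ∀ {n m} → Literal n → Fin m → Sym n m
leftSym (lit i true)  j = p i j
leftSym (lit i false) j = pb i j

rightSym : ∀ {n m} → Literal n → Fin m → Sym n m
rightSym (lit i true)  j = q i j
rightSym (lit i false) j = qb i j

encodeClause : ∀ {n m} → Fin m → Clause n → List (Sym n m)
encodeClause {n} j C =
  ℓ (j ↑ˡ n) ∷ leftSym za j ∷ leftSym zb j ∷ leftSym zc j
    ∷ rightSym za j ∷ rightSym zb j ∷ rightSym zc j ∷ r (j ↑ˡ n) ∷ []
  where open Clause C

varGadget : ∀ {n m} → Fin n → List (Sym n m)
varGadget {n} {m} i = ℓ (m ↑ʳ i) ∷ u i ∷ υ i ∷ r (m ↑ʳ i) ∷ []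

perm : ∀ {n m} → CNF3 n m → List (Sym n m)
perm {n} {m} Φ =
  s ∷ concat (map (λ j → encodeClause j (lookup Φ j)) (allFin m))
    ++ concat (map varGadget (allFin n))

LitRed : ∀ {n m} → CNF3 n m → List (List (Sym n m) × List (Sym n m))
         → Fin n → Fin m → Bool → Set
LitRed Φ S i j b = RedJoin _≺ˢ_ (perm Φ) S (leftSym (lit i b) j) (rightSym (lit i b) j)

-- A red edge between the two symbols of a literal means that at some step they lie in one
-- block of the current sequence while neither has been moved.  A block is sorted and consists
-- of consecutive values, and block moves keep the unmoved symbols in their original relative
-- order.  Hence, if y is still unmoved when x and z are joined, then (i) if y lies between x
-- and z in π, its rank lies between theirs, and (ii) if its rank lies between theirs, y lies
-- between x and z in π.
-- Inside a clause encoding the literal of the larger variable comes first but has the larger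
-- ranks, so two literal edges in one clause violate (i) for the pair joined first; the edges
-- then map injectively to clauses, so there are at most m.  The ranks satisfy
-- p_i^j < p̄_i^k < q_i^j < q̄_i^k while the encodings of C^j and C^k are disjoint stretches
-- of π, so edges p_i^j q_i^j and p̄_i^k q̄_i^k violate (ii) for the pair joined first.

module Submission where

open import Defs
open import Data.Vec using (lookup)
open import Data.Nat using (ℕ; zero; suc; _+_; _*_; _∸_; _<_; _≤_; z≤n; s≤s; z<s)
open import Data.Nat.Properties
open import Data.Fin using (Fin; toℕ)
import Data.Fin as Fin
open import Data.Fin.Properties using (toℕ<n; toℕ-injective; toℕ-↑ˡ; toℕ-↑ʳ; injective⇒≤)
open import Data.Bool using (Bool; true; false)
open import Data.List using (List; []; _∷_; _++_; length; concat; map; allFin)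
  renaming (lookup to lookupᴸ)
open import Data.List.Membership.Propositional using (_∈_; _∉_)
open import Data.List.Membership.Propositional.Properties using (∈-++⁺ˡ; ∈-++⁺ʳ; ∈-++⁻; ∈-lookup; ∈-AllPairs₂)
open import Data.List.Relation.Unary.Any using (here; there)
open import Data.List.Relation.Unary.All as All using (All; _∷_)
import Data.List.Relation.Unary.All.Properties as All
open import Data.List.Relation.Unary.AllPairs as AllPairs using (AllPairs; _∷_)
import Data.List.Relation.Unary.AllPairs.Properties as AllPairs
open import Data.List.Relation.Unary.Linked as Linked using (Linked; [-]; _∷_)
open import Data.List.Relation.Unary.Linked.Properties using (Linked⇒AllPairs)
open import Data.List.Relation.Unary.Unique.Propositional using (Unique)
open import Data.List.Relation.Binary.Permutation.Propositional using (_↭_; ↭-sym; ↭-trans; ↭⇒↭ₛ)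
open import Data.List.Relation.Binary.Permutation.Propositional.Properties using (shifts)
import Data.List.Relation.Binary.Permutation.Setoid.Properties as Permutationₛ
open import Data.Product using (∃; _×_; _,_; proj₁; proj₂)
open import Data.Product.Relation.Binary.Lex.Strict using (×-Lex; ×-transitive; ×-asymmetric)
open import Data.Sum using (_⊎_; inj₁; inj₂; [_,_])
import Data.Sum as Sum
open import Data.Empty using (⊥; ⊥-elim)
open import Relation.Nullary using (¬_)
open import Function using (_∘′_; _on_)
open import Relation.Binary using (tri<; tri≈; tri>)
open import Relation.Binary.PropositionalEquality using (_≡_; _≢_; refl; sym; trans; cong; subst; subst₂)
open import Relation.Binary.PropositionalEquality.Properties using (setoid; isEquivalence)

-- Order of occurrence in a list

module _ {A : Set} where

  data Before (x y : A) : List A → Set where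
    now   : ∀ {σ} → y ∈ σ → Before x y (x ∷ σ)
    later : ∀ {z σ} → Before x y σ → Before x y (z ∷ σ)

  Before⇒∈ˡ : ∀ {x y σ} → Before x y σ → x ∈ σ
  Before⇒∈ˡ (now _)   = here refl
  Before⇒∈ˡ (later b) = there (Before⇒∈ˡ b)

  Before⇒∈ʳ : ∀ {x y σ} → Before x y σ → y ∈ σ
  Before⇒∈ʳ (now y∈)  = there y∈
  Before⇒∈ʳ (later b) = there (Before⇒∈ʳ b)

  Before-++⁺ˡ : ∀ {x y xs} ys → Before x y xs → Before x y (xs ++ ys)
  Before-++⁺ˡ ys (now y∈)  = now (∈-++⁺ˡ y∈)
  Before-++⁺ˡ ys (later b) = later (Before-++⁺ˡ ys b)

  Before-++⁺ʳ : ∀ {x y ys} xs → Before x y ys → Before x y (xs ++ ys)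
  Before-++⁺ʳ []       b = b
  Before-++⁺ʳ (_ ∷ xs) b = later (Before-++⁺ʳ xs b)

  Before-++⁺ : ∀ {x y xs ys} → x ∈ xs → y ∈ ys → Before x y (xs ++ ys)
  Before-++⁺ {xs = _ ∷ xs} (here refl) y∈ = now (∈-++⁺ʳ xs y∈)
  Before-++⁺ {xs = _ ∷ xs} (there x∈) y∈ = later (Before-++⁺ x∈ y∈)

  Before-++⁻ : ∀ {x y ys} xs → Before x y (xs ++ ys) →
               Before x y xs ⊎ (x ∈ xs × y ∈ ys) ⊎ Before x y ys
  Before-++⁻ []       b = inj₂ (inj₂ b)
  Before-++⁻ (_ ∷ xs) (now y∈) with ∈-++⁻ xs y∈
  ... | inj₁ y∈xs = inj₁ (now y∈xs)
  ... | inj₂ y∈ys = inj₂ (inj₁ (here refl , y∈ys))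
  Before-++⁻ (_ ∷ xs) (later b) with Before-++⁻ xs b
  ... | inj₁ b′               = inj₁ (later b′)
  ... | inj₂ (inj₁ (x∈ , y∈)) = inj₂ (inj₁ (there x∈ , y∈))
  ... | inj₂ (inj₂ b′)        = inj₂ (inj₂ b′)

  Before-remove : ∀ {x y} pre w post → x ∉ w → y ∉ w →
                  Before x y (pre ++ w ++ post) → Before x y (pre ++ post)
  Before-remove pre w post x∉w y∉w b with Before-++⁻ pre b
  ... | inj₁ b′ = Before-++⁺ˡ post b′
  ... | inj₂ (inj₁ (x∈ , y∈)) with ∈-++⁻ w y∈
  ...   | inj₁ y∈w    = ⊥-elim (y∉w y∈w)
  ...   | inj₂ y∈post = Before-++⁺ x∈ y∈post
  Before-remove pre w post x∉w y∉w b | inj₂ (inj₂ b′) with Before-++⁻ w b′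
  ...   | inj₁ b″              = ⊥-elim (x∉w (Before⇒∈ˡ b″))
  ...   | inj₂ (inj₁ (x∈ , _)) = ⊥-elim (x∉w x∈)
  ...   | inj₂ (inj₂ b″)       = Before-++⁺ʳ pre b″

  Before-insert : ∀ {x y} L w R → Before x y (L ++ R) → Before x y (L ++ w ++ R)
  Before-insert L w R b with Before-++⁻ L b
  ... | inj₁ b′               = Before-++⁺ˡ (w ++ R) b′
  ... | inj₂ (inj₁ (x∈ , y∈)) = Before-++⁺ x∈ (∈-++⁺ʳ w y∈)
  ... | inj₂ (inj₂ b′)        = Before-++⁺ʳ L (Before-++⁺ʳ w b′)

  Before-AllPairs : ∀ {R : A → A → Set} {x y xs} → AllPairs R xs → Before x y xs → R x y
  Before-AllPairs (Rx ∷ _)  (now y∈)  = All.lookup Rx y∈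
  Before-AllPairs (_ ∷ Rxs) (later b) = Before-AllPairs Rxs b

  AllPairs⇒Before : ∀ {R : A → A → Set} {x y xs} → (∀ {a b} → R a b → ¬ R b a) →
                    AllPairs R xs → x ∈ xs → y ∈ xs → R x y → Before x y xs
  AllPairs⇒Before asym (_ ∷ _)    (here refl) (here refl) Rxx = ⊥-elim (asym Rxx Rxx)
  AllPairs⇒Before asym (_ ∷ _)    (here refl) (there y∈)  _   = now y∈
  AllPairs⇒Before asym (Rz ∷ _)   (there x∈)  (here refl) Rxy = ⊥-elim (asym Rxy (All.lookup Rz x∈))
  AllPairs⇒Before asym (_ ∷ Rxs)  (there x∈)  (there y∈)  Rxy = later (AllPairs⇒Before asym Rxs x∈ y∈ Rxy)

  Unique-++⁻ʳ : ∀ xs {ys : List A} → Unique (xs ++ ys) → Unique ys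
  Unique-++⁻ʳ []       uq       = uq
  Unique-++⁻ʳ (_ ∷ xs) (_ ∷ uq) = Unique-++⁻ʳ xs uq

  Unique-++-disjoint : ∀ xs {ys : List A} {x} → Unique (xs ++ ys) → x ∈ xs → x ∉ ys
  Unique-++-disjoint (_ ∷ xs) (x∉ ∷ _) (here refl) x∈ys = All.lookup x∉ (∈-++⁺ʳ xs x∈ys) refl
  Unique-++-disjoint (_ ∷ xs) (_ ∷ uq)  (there x∈)  x∈ys = Unique-++-disjoint xs uq x∈ x∈ys

  Unique-resp-↭ : ∀ {xs ys : List A} → xs ↭ ys → Unique xs → Unique ys
  Unique-resp-↭ xs↭ys = Permutationₛ.Unique-resp-↭ (setoid A) (↭⇒↭ₛ xs↭ys)

  Before-++⁻ʳ : ∀ xs {ys : List A} {x y} → Unique (xs ++ ys) → x ∈ ys →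
                Before x y (xs ++ ys) → Before x y ys
  Before-++⁻ʳ xs uq x∈ys b with Before-++⁻ xs b
  ... | inj₁ b′              = ⊥-elim (Unique-++-disjoint xs uq (Before⇒∈ˡ b′) x∈ys)
  ... | inj₂ (inj₁ (x∈ , _)) = ⊥-elim (Unique-++-disjoint xs uq x∈ x∈ys)
  ... | inj₂ (inj₂ b′)       = b′

  Before-++⁻ˡ : ∀ xs {ys : List A} {x y} → Unique (xs ++ ys) → y ∈ xs →
                Before x y (xs ++ ys) → Before x y xs
  Before-++⁻ˡ xs uq y∈xs b with Before-++⁻ xs b
  ... | inj₁ b′              = b′
  ... | inj₂ (inj₁ (_ , y∈)) = ⊥-elim (Unique-++-disjoint xs uq y∈xs y∈)
  ... | inj₂ (inj₂ b′)       = ⊥-elim (Unique-++-disjoint xs uq y∈xs (Before⇒∈ʳ b′))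

  Before-segment : ∀ pre Z post {x y} → Unique (pre ++ Z ++ post) → x ∈ Z → y ∈ Z →
                   Before x y (pre ++ Z ++ post) → Before x y Z
  Before-segment pre Z post uq x∈ y∈ =
    Before-++⁻ˡ Z (Unique-++⁻ʳ pre uq) y∈ ∘′ Before-++⁻ʳ pre uq (∈-++⁺ˡ x∈)

  Before-segment-convex : ∀ pre Z post {x y z} → Unique (pre ++ Z ++ post) → x ∈ Z → z ∈ Z →
                          Before x y (pre ++ Z ++ post) → Before y z (pre ++ Z ++ post) → y ∈ Z
  Before-segment-convex pre Z post uq x∈ z∈ xy yz
    with ∈-++⁻ Z (Before⇒∈ʳ (Before-++⁻ʳ pre uq (∈-++⁺ˡ x∈) xy))
  ... | inj₁ y∈Z = y∈Z
  ... | inj₂ y∈post with Before-++⁻ pre yz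
  ...   | inj₁ b               = ⊥-elim (Unique-++-disjoint pre uq (Before⇒∈ʳ b) (∈-++⁺ˡ z∈))
  ...   | inj₂ (inj₁ (y∈ , _)) = ⊥-elim (Unique-++-disjoint pre uq y∈ (∈-++⁺ʳ Z y∈post))
  ...   | inj₂ (inj₂ b)        = Before⇒∈ˡ (Before-++⁻ˡ Z (Unique-++⁻ʳ pre uq) z∈ b)

  Unique-lookup-injective : ∀ {xs : List A} → Unique xs → ∀ a b → lookupᴸ xs a ≡ lookupᴸ xs b → a ≡ b
  Unique-lookup-injective (_ ∷ _)  Fin.zero    Fin.zero    _  = refl
  Unique-lookup-injective (x∉ ∷ _) Fin.zero    (Fin.suc b) eq = ⊥-elim (All.lookup x∉ (∈-lookup b) eq)
  Unique-lookup-injective (x∉ ∷ _) (Fin.suc a) Fin.zero    eq = ⊥-elim (All.lookup x∉ (∈-lookup a) (sym eq))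
  Unique-lookup-injective (_ ∷ uq) (Fin.suc a) (Fin.suc b) eq = cong Fin.suc (Unique-lookup-injective uq a b eq)

  Unique-length≤ : ∀ {k} {P : A → Set} (f : A → Fin k) →
                   (∀ {x y} → P x → P y → f x ≡ f y → x ≡ y) →
                   ∀ {xs} → Unique xs → All P xs → length xs ≤ k
  Unique-length≤ f inj {xs} uq Pxs = injective⇒≤ λ {a} {b} eq →
    Unique-lookup-injective uq a b (inj (All.lookup Pxs (∈-lookup a)) (All.lookup Pxs (∈-lookup b)) eq)

-- Block sorting with respect to a rank function

module Ranked {A : Set} (rk : A → ℕ) where

  private
    _≺_ : A → A → Set
    a ≺ b = rk a < rk b

  Schedule : Set
  Schedule = List (List A × List A)

  Unmoved : Schedule → A → ℕ → Set
  Unmoved S x J = ∀ t → t ≤ J → x ∉ movedBlock _≺_ S t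

  RankUnique : A → Set
  RankUnique y = ∀ x → rk x ≡ rk y → x ≡ y

  Unmoved-≤ : ∀ {S x I J} → I ≤ J → Unmoved S x J → Unmoved S x I
  Unmoved-≤ I≤J unmoved t t≤I = unmoved t (≤-trans t≤I I≤J)

  Unmoved-tail : ∀ {w σ S x} J → Unmoved ((w , σ) ∷ S) x (suc J) → Unmoved S x J
  Unmoved-tail {S = []}    J unmoved zero    _   ()
  Unmoved-tail {S = _ ∷ _} J unmoved zero    _   ()
  Unmoved-tail             J unmoved (suc t) t≤J = unmoved (suc (suc t)) (s≤s t≤J)

  BlockMove⇒↭ : ∀ {σ w σ′} → BlockMove _≺_ σ w σ′ → σ ↭ σ′
  BlockMove⇒↭ {w = w} (pre , post , L , R , (refl , _) , pre++post≡L++R , refl , _) =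
    ↭-trans (shifts pre w) (subst (λ τ → w ++ τ ↭ L ++ w ++ R) (sym pre++post≡L++R) (↭-sym (shifts L w)))

  Unique-stateAt : ∀ {π S} → IsSchedule _≺_ π S → Unique π → ∀ J → Unique (stateAt _≺_ π S J)
  Unique-stateAt sch            uq zero    = uq
  Unique-stateAt (done _)       uq (suc J) = uq
  Unique-stateAt (move mv sch)  uq (suc J) = Unique-stateAt sch (Unique-resp-↭ (BlockMove⇒↭ mv) uq) J

  Before-stateAt : ∀ {π S x y} → IsSchedule _≺_ π S → ∀ J → Unmoved S x J → Unmoved S y J →
                   Before x y π → Before x y (stateAt _≺_ π S J)
  Before-stateAt sch      zero    _  _  b = b
  Before-stateAt (done _) (suc J) _  _  b = b
  Before-stateAt (move {w = w} (pre , post , L , R , (refl , _) , pre++post≡L++R , refl , _) sch) (suc J) x-un y-un b =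
    Before-stateAt sch J (Unmoved-tail J x-un) (Unmoved-tail J y-un)
      (Before-insert L w R (subst (Before _ _) pre++post≡L++R
        (Before-remove pre w post (x-un 1 (s≤s z≤n)) (y-un 1 (s≤s z≤n)) b)))

  block-sorted : ∀ {σ Z} → Linked (Succ _≺_ σ) Z → AllPairs _≺_ Z
  block-sorted lk = Linked⇒AllPairs <-trans (Linked.map (λ (_ , _ , a≺b , _) → a≺b) lk)

  block-rank-convex : ∀ {σ Z x y z} → Linked (Succ _≺_ σ) Z → x ∈ Z → z ∈ Z → y ∈ σ →
                      rk x < rk y → rk y < rk z → RankUnique y → y ∈ Z
  block-rank-convex lk (here refl) (here refl) _ x<y y<z _ = ⊥-elim (<-asym x<y y<z)
  block-rank-convex {Z = _ ∷ []} lk (here refl) (there ()) _ _ _ _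
  block-rank-convex {Z = _ ∷ b ∷ _} {y = y} (a↝b ∷ lk) (here refl) (there z∈) y∈ x<y y<z unique
    with <-cmp (rk y) (rk b)
  ... | tri< y<b _ _ = ⊥-elim (proj₂ (proj₂ (proj₂ a↝b)) y y∈ x<y y<b)
  ... | tri≈ _ y≡b _ = there (here (sym (unique b (sym y≡b))))
  ... | tri> _ _ b<y = there (block-rank-convex lk (here refl) z∈ y∈ b<y y<z unique)
  block-rank-convex lk (there x∈) (here refl) _ x<y y<z _ with block-sorted lk
  ... | z≺ ∷ _ = ⊥-elim (<-asym (<-trans (All.lookup z≺ x∈) x<y) y<z)
  block-rank-convex (_ ∷ lk) (there x∈) (there z∈) y∈ x<y y<z unique =
    there (block-rank-convex lk x∈ z∈ y∈ x<y y<z unique)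

  block-ordered : ∀ {σ pre Z post a b} → BlockAt _≺_ σ pre Z post → Unique σ →
                  a ∈ Z → b ∈ Z → Before a b σ → rk a < rk b
  block-ordered {pre = pre} {Z} {post} (refl , _ , lk , _) uq a∈ b∈ =
    Before-AllPairs (block-sorted lk) ∘′ Before-segment pre Z post uq a∈ b∈

  block-position-convex : ∀ {σ pre Z post x y z} → BlockAt _≺_ σ pre Z post → Unique σ →
                          x ∈ Z → z ∈ Z → Before x y σ → Before y z σ → rk x < rk y × rk y < rk z
  block-position-convex {pre = pre} {Z} {post} {y = y} blk@(refl , _) uq x∈ z∈ xy yz =
    block-ordered blk uq x∈ y∈ xy , block-ordered blk uq y∈ z∈ yz
    where
      y∈ : y ∈ Z
      y∈ = Before-segment-convex pre Z post uq x∈ z∈ xy yz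

  block-rank-gap : ∀ {σ pre Z post x y z} → BlockAt _≺_ σ pre Z post → Unique σ → x ∈ Z → z ∈ Z →
                   rk x < rk y → rk y < rk z → RankUnique y → ¬ (Before z y σ ⊎ Before y x σ)
  block-rank-gap {Z = Z} {y = y} blk@(_ , _ , lk , _) uq x∈ z∈ x<y y<z unique outside =
    [ (λ zy → <-asym y<z (block-ordered blk uq z∈ y∈ zy))
    , (λ yx → <-asym x<y (block-ordered blk uq y∈ x∈ yx)) ] outside
    where
      y∈ : y ∈ Z
      y∈ = block-rank-convex lk x∈ z∈ ([ Before⇒∈ʳ , Before⇒∈ˡ ] outside) x<y y<z unique

  record Joined (π : List A) (S : Schedule) (x y : A) : Set where
    field
      step            : ℕ
      pre block post  : List A
      isBlock         : BlockAt _≺_ (stateAt _≺_ π S step) pre block post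
      x∈block         : x ∈ block
      y∈block         : y ∈ block
      x-unmoved       : Unmoved S x step
      y-unmoved       : Unmoved S y step
      x∈π             : x ∈ π
      y∈π             : y ∈ π

  IsBlock⇒⊆ : ∀ {π X x} → IsBlock _≺_ π X → x ∈ X → x ∈ π
  IsBlock⇒⊆ (pre , _ , refl , _) x∈ = ∈-++⁺ʳ pre (∈-++⁺ˡ x∈)

  RedJoin⇒Joined : ∀ {π S x y} → rk x < rk y → RedJoin _≺_ π S x y → Joined π S x y
  RedJoin⇒Joined x<y (_ , _ , x∈X , y∈Y , inj₂ (_ , _ , Y≺X , _)) = ⊥-elim (<-asym x<y (Y≺X _ _ y∈Y x∈X))
  RedJoin⇒Joined {x = x} {y} x<y
    (_ , _ , x∈X , y∈Y , inj₁ (X-block , Y-block , _ , _ , _ , _ , _ , J , (together , _) , unmoved , _))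
    with together
  ... | Z , (pre , post , Z-block) , X⊆Z , Y⊆Z = record
    { step = J ; pre = pre ; block = Z ; post = post ; isBlock = Z-block
    ; x∈block = X⊆Z x∈X ; y∈block = Y⊆Z y∈Y
    ; x-unmoved = λ t t≤J x∈moved → proj₁ (unmoved t t≤J) (x , x∈X , x∈moved)
    ; y-unmoved = λ t t≤J y∈moved → proj₂ (unmoved t t≤J) (y , y∈Y , y∈moved)
    ; x∈π = IsBlock⇒⊆ X-block x∈X ; y∈π = IsBlock⇒⊆ Y-block y∈Y
    }

  module _ {π S} (sch : IsSchedule _≺_ π S) (π-unique : Unique π) where
    open Joined

    Joined-position-convex : ∀ {x y z} (j : Joined π S x z) → Unmoved S y (step j) →
                             Before x y π → Before y z π → rk x < rk y × rk y < rk z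
    Joined-position-convex j mid-unmoved xy yz =
      block-position-convex (isBlock j) (Unique-stateAt sch π-unique (step j)) (x∈block j) (y∈block j)
        (Before-stateAt sch (step j) (x-unmoved j) mid-unmoved xy)
        (Before-stateAt sch (step j) mid-unmoved (y-unmoved j) yz)

    Joined-rank-gap : ∀ {x y z} (j : Joined π S x z) → Unmoved S y (step j) →
                      rk x < rk y → rk y < rk z → RankUnique y → ¬ (Before z y π ⊎ Before y x π)
    Joined-rank-gap j mid-unmoved x<y y<z unique outside =
      block-rank-gap (isBlock j) (Unique-stateAt sch π-unique (step j)) (x∈block j) (y∈block j)
        x<y y<z unique (Sum.map
          (Before-stateAt sch (step j) (y-unmoved j) mid-unmoved)
          (Before-stateAt sch (step j) mid-unmoved (x-unmoved j)) outside)

    crossing-joins : ∀ {x₁ z₁ x₂ z₂} → Joined π S x₁ z₁ → Joined π S x₂ z₂ →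
                     Before x₁ x₂ π → Before x₂ z₁ π → Before z₁ z₂ π →
                     rk x₂ < rk x₁ → rk z₂ < rk z₁ → ⊥
    crossing-joins j₁ j₂ x₁x₂ x₂z₁ z₁z₂ x₂<x₁ z₂<z₁ with ≤-total (step j₁) (step j₂)
    ... | inj₁ j₁≤j₂ = <-asym x₂<x₁
      (proj₁ (Joined-position-convex j₁ (Unmoved-≤ {S = S} j₁≤j₂ (x-unmoved j₂)) x₁x₂ x₂z₁))
    ... | inj₂ j₂≤j₁ = <-asym z₂<z₁
      (proj₂ (Joined-position-convex j₂ (Unmoved-≤ {S = S} j₂≤j₁ (y-unmoved j₁)) x₂z₁ z₁z₂))

    overlapping-joins : ∀ {x z x′ z′} → Joined π S x z → Joined π S x′ z′ →
                        rk x < rk x′ → rk x′ < rk z → rk z < rk z′ → RankUnique x′ → RankUnique z →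
                        Before z x′ π ⊎ (Before x′ x π × Before z′ z π) → ⊥
    overlapping-joins j j′ x<x′ x′<z z<z′ x′-unique z-unique apart with ≤-total (step j) (step j′)
    ... | inj₁ j≤j′ = Joined-rank-gap j (Unmoved-≤ {S = S} j≤j′ (x-unmoved j′)) x<x′ x′<z x′-unique
      (Sum.map₂ proj₁ apart)
    ... | inj₂ j′≤j = Joined-rank-gap j′ (Unmoved-≤ {S = S} j′≤j (y-unmoved j)) x′<z z<z′ z-unique
      ([ inj₂ , inj₁ ∘′ proj₂ ] apart)

_<ₗₑₓ_ : ℕ × ℕ → ℕ × ℕ → Set
_<ₗₑₓ_ = ×-Lex _≡_ _<_ _<_

<ₗₑₓ-trans : ∀ {a b c} → a <ₗₑₓ b → b <ₗₑₓ c → a <ₗₑₓ c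
<ₗₑₓ-trans = ×-transitive {_<₂_ = _<_} isEquivalence <-resp₂-≡ <-trans <-trans

<ₗₑₓ-asym : ∀ {a b} → a <ₗₑₓ b → ¬ b <ₗₑₓ a
<ₗₑₓ-asym = ×-asymmetric {_<₂_ = _<_} sym <-resp₂-≡ <-asym <-asym

<ₗₑₓ-irrefl : ∀ {a} → ¬ a <ₗₑₓ a
<ₗₑₓ-irrefl a<a = <ₗₑₓ-asym a<a a<a

module _ {A : Set} (key : A → ℕ × ℕ) where

  segments-sorted : ∀ {k} (f : Fin k → List A) c →
    (∀ i → AllPairs (_<ₗₑₓ_ on key) (f i)) → (∀ i → All (λ x → proj₁ (key x) ≡ c + toℕ i) (f i)) →
    let xs = concat (map f (allFin k)) in
    AllPairs (_<ₗₑₓ_ on key) xs × All (λ x → c ≤ proj₁ (key x) × proj₁ (key x) < c + k) xs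
  segments-sorted {k} f c sorted segment =
    AllPairs.concat⁺ (All.map⁺ (All.tabulate⁺ sorted)) (AllPairs.map⁺ (AllPairs.tabulate⁺-< ordered)) ,
    All.concat⁺ (All.map⁺ (All.tabulate⁺ λ i → All.map (λ seg≡ → bounds i seg≡) (segment i)))
    where
      ordered : ∀ {i j} → i Fin.< j → All (λ x → All ((_<ₗₑₓ_ on key) x) (f j)) (f i)
      ordered i<j = All.map (λ x≡ → All.map (λ y≡ → inj₁ (subst₂ _<_ (sym x≡) (sym y≡) (+-monoʳ-< c i<j))) (segment _)) (segment _)
      bounds : ∀ i {s} → s ≡ c + toℕ i → c ≤ s × s < c + k
      bounds i refl = m≤m+n c (toℕ i) , +-monoʳ-< c (toℕ<n i)

-- Positions of the symbols in π

rev : ∀ {n} → Fin n → ℕ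
rev {n} i = n ∸ suc (toℕ i)

rev<n : ∀ {n} (i : Fin n) → rev i < n
rev<n i = ∸-monoʳ-< z<s (toℕ<n i)

rev-mono : ∀ {n} {i i′ : Fin n} → toℕ i < toℕ i′ → rev i′ < rev i
rev-mono {i′ = i′} i<i′ = ∸-monoʳ-< (s≤s i<i′) (toℕ<n i′)

rev-injective : ∀ {n} {i i′ : Fin n} → rev i ≡ rev i′ → i ≡ i′
rev-injective {i = i} {i′} eq = toℕ-injective (suc-injective (∸-cancelˡ-≡ (toℕ<n i) (toℕ<n i′) eq))

module _ {n m : ℕ} where

  -- (segment, slot): segment 0 is s, segment 1 + j the encoding of C^j and
  -- segment 1 + m + i the gadget of x_i.
  position : Sym n m → ℕ × ℕ
  position s        = 0 , 0
  position (ℓ J)    = suc (toℕ J) , 0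
  position (p i j)  = suc (toℕ j) , suc (rev i)
  position (pb i j) = suc (toℕ j) , suc (rev i)
  position (q i j)  = suc (toℕ j) , suc (n + rev i)
  position (qb i j) = suc (toℕ j) , suc (n + rev i)
  position (r J)    = suc (toℕ J) , 3 + n + n
  position (u i)    = suc (m + toℕ i) , 1
  position (υ i)    = suc (m + toℕ i) , 2

  position-leftSym : ∀ l j → position (leftSym l j) ≡ (suc (toℕ j) , suc (rev (Literal.var l)))
  position-leftSym (lit i true)  j = refl
  position-leftSym (lit i false) j = refl

  position-rightSym : ∀ l j → position (rightSym l j) ≡ (suc (toℕ j) , suc (n + rev (Literal.var l)))
  position-rightSym (lit i true)  j = refl
  position-rightSym (lit i false) j = refl

  segment-sorted : ∀ {B} (xs : List (Sym n m)) (slots : List ℕ) → map position xs ≡ map (B ,_) slots →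
                   Linked _<_ slots → AllPairs (_<ₗₑₓ_ on position) xs × All (λ x → proj₁ (position x) ≡ B) xs
  segment-sorted {B} xs slots xs≡ increasing =
    AllPairs.map⁻ (subst (AllPairs _<ₗₑₓ_) (sym xs≡)
      (AllPairs.map⁺ (Linked⇒AllPairs <ₗₑₓ-trans in-segment))) ,
    All.map⁻ (subst (All (λ k → proj₁ k ≡ B)) (sym xs≡) (All.map⁺ (All.universal (λ _ → refl) slots)))
    where
      in-segment : Linked (_<ₗₑₓ_ on (B ,_)) slots
      in-segment = Linked.map (λ a<b → inj₂ (refl , a<b)) increasing

  clause-sorted : ∀ j (C : Clause n) →
    AllPairs (_<ₗₑₓ_ on position) (encodeClause j C) × All (λ x → proj₁ (position x) ≡ 1 + toℕ j) (encodeClause j C)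
  clause-sorted j C = segment-sorted (encodeClause j C) slots positions
    (z<s ∷ s≤s (rev-mono a>b) ∷ s≤s (rev-mono b>c) ∷ s≤s (<-≤-trans (rev<n _) (m≤m+n n a))
      ∷ s≤s (+-monoʳ-< n (rev-mono a>b)) ∷ s≤s (+-monoʳ-< n (rev-mono b>c))
      ∷ s≤s (m<n⇒m<1+n (m<n⇒m<1+n (+-monoʳ-< n (rev<n _)))) ∷ [-])
    where
      open Clause C
      a b c : ℕ
      a = rev (Literal.var za)
      b = rev (Literal.var zb)
      c = rev (Literal.var zc)
      slots : List ℕ
      slots = 0 ∷ suc a ∷ suc b ∷ suc c ∷ suc (n + a) ∷ suc (n + b) ∷ suc (n + c) ∷ 3 + n + n ∷ []
      positions : map position (encodeClause j C) ≡ map (suc (toℕ j) ,_) slots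
      positions rewrite toℕ-↑ˡ j n | position-leftSym za j | position-leftSym zb j | position-leftSym zc j
                      | position-rightSym za j | position-rightSym zb j | position-rightSym zc j = refl

  gadget-sorted : ∀ i →
    AllPairs (_<ₗₑₓ_ on position) (varGadget {n} {m} i) × All (λ x → proj₁ (position x) ≡ suc m + toℕ i) (varGadget i)
  gadget-sorted i = segment-sorted (varGadget i) (0 ∷ 1 ∷ 2 ∷ 3 + n + n ∷ []) positions
    (z<s ∷ s≤s z<s ∷ s≤s (s≤s z<s) ∷ [-])
    where
      positions : map position (varGadget {n} {m} i) ≡ map (suc (m + toℕ i) ,_) (0 ∷ 1 ∷ 2 ∷ 3 + n + n ∷ [])
      positions rewrite toℕ-↑ʳ m i = refl

module _ {n m : ℕ} (Φ : CNF3 n m) where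

  π-sorted : AllPairs (_<ₗₑₓ_ on position) (perm Φ)
  π-sorted
    with segments-sorted position (λ j → encodeClause j (lookup Φ j)) 1
           (λ j → proj₁ (clause-sorted j (lookup Φ j))) (λ j → proj₂ (clause-sorted j (lookup Φ j)))
       | segments-sorted position varGadget (suc m) (λ i → proj₁ (gadget-sorted i)) (λ i → proj₂ (gadget-sorted i))
  ... | clauses-sorted , clauses-in | gadgets-sorted , gadgets-in =
    All.++⁺ (All.map (λ (1≤ , _) → inj₁ 1≤) clauses-in)
            (All.map (λ (1+m≤ , _) → inj₁ (<-≤-trans z<s 1+m≤)) gadgets-in)
    ∷ AllPairs.++⁺ clauses-sorted gadgets-sorted
        (All.map (λ (_ , <1+m) → All.map (λ (1+m≤ , _) → inj₁ (<-≤-trans <1+m 1+m≤)) gadgets-in) clauses-in)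

  π-unique : Unique (perm Φ)
  π-unique = AllPairs.map (λ x<y x≡y → <ₗₑₓ-irrefl (subst (λ z → position z <ₗₑₓ _) x≡y x<y)) π-sorted

  position⇒Before : ∀ {x y} → x ∈ perm Φ → y ∈ perm Φ → position x <ₗₑₓ position y → Before x y (perm Φ)
  position⇒Before = AllPairs⇒Before <ₗₑₓ-asym π-sorted

  position-injective : ∀ {x y} → x ∈ perm Φ → y ∈ perm Φ → position x ≡ position y → x ≡ y
  position-injective x∈ y∈ x≡y with ∈-AllPairs₂ π-sorted x∈ y∈
  ... | inj₁ x≡y′       = x≡y′
  ... | inj₂ (inj₁ x<y) = ⊥-elim (<ₗₑₓ-irrefl (subst (_<ₗₑₓ _) x≡y x<y))
  ... | inj₂ (inj₂ y<x) = ⊥-elim (<ₗₑₓ-irrefl (subst (_ <ₗₑₓ_) x≡y y<x))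

quotient-remainder-unique : ∀ d {i i′ o o′} → o < d → o′ < d → i * d + o ≡ i′ * d + o′ → i ≡ i′ × o ≡ o′
quotient-remainder-unique d {zero}  {zero}   _   _    eq = refl , eq
quotient-remainder-unique d {zero}  {suc i′} o<d _    eq = ⊥-elim (<⇒≱ o<d (subst (d ≤_) (sym eq) (≤-trans (m≤m+n d _) (m≤m+n _ _))))
quotient-remainder-unique d {suc i} {zero}   _   o′<d eq = ⊥-elim (<⇒≱ o′<d (subst (d ≤_) eq (≤-trans (m≤m+n d _) (m≤m+n _ _))))
quotient-remainder-unique d {suc i} {suc i′} o<d o′<d eq
  with quotient-remainder-unique d o<d o′<d (+-cancelˡ-≡ d _ _ (trans (sym (+-assoc d _ _)) (trans eq (+-assoc d _ _))))
... | i≡i′ , o≡o′ = cong suc i≡i′ , o≡o′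

quotient-< : ∀ d {a b o o′} → a < b → o < d → a * d + o < b * d + o′
quotient-< d {a} {b} {o} {o′} a<b o<d = begin-strict
  a * d + o   <⟨ +-monoʳ-< (a * d) o<d ⟩
  a * d + d   ≡⟨ +-comm (a * d) d ⟩
  suc a * d   ≤⟨ *-monoˡ-≤ d a<b ⟩
  b * d       ≤⟨ m≤m+n (b * d) o′ ⟩
  b * d + o′  ∎
  where open ≤-Reasoning

-- The offsets of p, p̄, q, q̄ lie in the consecutive slices (k m, (k + 1) m] for k = 0, 1, 2, 3.
slice-< : ∀ {m k k′ a b} → k < k′ → a < m → suc (k * m + a) < suc (k′ * m + b)
slice-< {m} k<k′ a<m = s≤s (quotient-< m k<k′ a<m)

module _ {n m : ℕ} where

  stride : ℕ
  stride = 4 * m + 2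

  -- The symbols whose ranks fill the interval [i · stride, (i + 1) · stride).
  data VarSym (i : Fin n) : Sym n m → Set where
    u-sym  : VarSym i (u i)
    p-sym  : ∀ j → VarSym i (p i j)
    pb-sym : ∀ j → VarSym i (pb i j)
    q-sym  : ∀ j → VarSym i (q i j)
    qb-sym : ∀ j → VarSym i (qb i j)
    υ-sym  : VarSym i (υ i)

  offset : ∀ {i x} → VarSym i x → ℕ
  offset u-sym      = 0
  offset (p-sym j)  = suc (rev j)
  offset (pb-sym j) = suc (1 * m + rev j)
  offset (q-sym j)  = suc (2 * m + toℕ j)
  offset (qb-sym j) = suc (3 * m + toℕ j)
  offset υ-sym      = suc (4 * m + 0)

  rank-VarSym : ∀ {i x} (v : VarSym i x) → rank x ≡ toℕ i * stride + offset v
  rank-VarSym u-sym          = sym (+-identityʳ _)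
  rank-VarSym {i} (p-sym j)  = +-assoc (toℕ i * stride) 1 (rev j)
  rank-VarSym {i} (pb-sym j) = trans (+-assoc (toℕ i * stride + 1) m (rev j))
    (trans (+-assoc (toℕ i * stride) 1 (m + rev j)) (cong (λ k → toℕ i * stride + suc (k + rev j)) (sym (*-identityˡ m))))
  rank-VarSym {i} (q-sym j)  = trans (+-assoc (toℕ i * stride + 1) (2 * m) (toℕ j)) (+-assoc (toℕ i * stride) 1 (2 * m + toℕ j))
  rank-VarSym {i} (qb-sym j) = trans (+-assoc (toℕ i * stride + 1) (3 * m) (toℕ j)) (+-assoc (toℕ i * stride) 1 (3 * m + toℕ j))
  rank-VarSym {i} υ-sym      = trans (+-assoc (toℕ i * stride) (4 * m) 1) (cong (toℕ i * stride +_) (+-suc (4 * m) 0))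

  offset≤ : ∀ {i x} (v : VarSym i x) → offset v ≤ suc (4 * m + 0)
  offset≤ u-sym      = z≤n
  offset≤ (p-sym j)  = <⇒≤ (slice-< {k = 0} {k′ = 4} (s≤s z≤n) (rev<n j))
  offset≤ (pb-sym j) = <⇒≤ (slice-< {k = 1} {k′ = 4} (s≤s (s≤s z≤n)) (rev<n j))
  offset≤ (q-sym j)  = <⇒≤ (slice-< {k = 2} {k′ = 4} (s≤s (s≤s (s≤s z≤n))) (toℕ<n j))
  offset≤ (qb-sym j) = <⇒≤ (slice-< {k = 3} {k′ = 4} ≤-refl (toℕ<n j))
  offset≤ υ-sym      = ≤-refl

  offset<stride : ∀ {i x} (v : VarSym i x) → offset v < stride
  offset<stride v = subst (offset v <_) (sym (trans (+-suc (4 * m) 1) (cong suc (+-suc (4 * m) 0)))) (s≤s (offset≤ v))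

  offset-<⇒rank-< : ∀ {i x y} (v : VarSym i x) (w : VarSym i y) → offset v < offset w → rank x < rank y
  offset-<⇒rank-< {i} v w v<w = subst₂ _<_ (sym (rank-VarSym v)) (sym (rank-VarSym w)) (+-monoʳ-< (toℕ i * stride) v<w)

  VarSym-< : ∀ {i i′ x y} → toℕ i < toℕ i′ → VarSym i x → VarSym i′ y → rank x < rank y
  VarSym-< i<i′ v w = subst₂ _<_ (sym (rank-VarSym v)) (sym (rank-VarSym w)) (quotient-< stride i<i′ (offset<stride v))

  VarSym-below : ∀ {i x} → VarSym i x → rank x < n * stride
  VarSym-below {i} v = subst₂ _<_ (sym (rank-VarSym v)) (+-identityʳ (n * stride)) (quotient-< stride (toℕ<n i) (offset<stride v))

  VarSym-or-above : ∀ x → (∃ λ i → VarSym i x) ⊎ n * stride ≤ rank x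
  VarSym-or-above s        = inj₂ ≤-refl
  VarSym-or-above (ℓ J)    = inj₂ (≤-trans (m≤m+n (n * stride) 1) (m≤m+n _ _))
  VarSym-or-above (r J)    = inj₂ (≤-trans (m≤m+n (n * stride) 2) (m≤m+n _ _))
  VarSym-or-above (u i)    = inj₁ (i , u-sym)
  VarSym-or-above (υ i)    = inj₁ (i , υ-sym)
  VarSym-or-above (p i j)  = inj₁ (i , p-sym j)
  VarSym-or-above (pb i j) = inj₁ (i , pb-sym j)
  VarSym-or-above (q i j)  = inj₁ (i , q-sym j)
  VarSym-or-above (qb i j) = inj₁ (i , qb-sym j)

  VarSym-rank-injective : ∀ {i i′ x y} (v : VarSym i x) (w : VarSym i′ y) → rank x ≡ rank y →
                          i ≡ i′ × offset v ≡ offset w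
  VarSym-rank-injective v w x≡y with quotient-remainder-unique stride (offset<stride v) (offset<stride w)
    (trans (sym (rank-VarSym v)) (trans x≡y (rank-VarSym w)))
  ... | i≡i′ , v≡w = toℕ-injective i≡i′ , v≡w

  rank-unique : ∀ {i y} (w : VarSym i y) → (∀ {x} (v : VarSym i x) → offset v ≡ offset w → x ≡ y) →
                Ranked.RankUnique rank y
  rank-unique w offset-unique x x≡y with VarSym-or-above x
  ... | inj₂ above = ⊥-elim (<⇒≱ (VarSym-below w) (subst (_ ≤_) x≡y above))
  ... | inj₁ (_ , v) with VarSym-rank-injective v w x≡y
  ...   | refl , v≡w = offset-unique v v≡w

  pb-rank-unique : ∀ i k → Ranked.RankUnique rank (pb i k)
  pb-rank-unique i k = rank-unique (pb-sym k) unique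
    where
      unique : ∀ {x} (v : VarSym i x) → offset v ≡ offset (pb-sym {i} k) → x ≡ pb i k
      unique u-sym      ()
      unique (p-sym j)  eq = ⊥-elim (<⇒≢ (slice-< {k = 0} {k′ = 1} z<s (rev<n j)) eq)
      unique (pb-sym j) eq = cong (pb i) (rev-injective (+-cancelˡ-≡ (1 * m) _ _ (suc-injective eq)))
      unique (q-sym j)  eq = ⊥-elim (<⇒≢ (slice-< {k = 1} {k′ = 2} ≤-refl (rev<n k)) (sym eq))
      unique (qb-sym j) eq = ⊥-elim (<⇒≢ (slice-< {k = 1} {k′ = 3} (s≤s (s≤s z≤n)) (rev<n k)) (sym eq))
      unique υ-sym      eq = ⊥-elim (<⇒≢ (slice-< {k = 1} {k′ = 4} (s≤s (s≤s z≤n)) (rev<n k)) (sym eq))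

  q-rank-unique : ∀ i j → Ranked.RankUnique rank (q i j)
  q-rank-unique i j = rank-unique (q-sym j) unique
    where
      unique : ∀ {x} (v : VarSym i x) → offset v ≡ offset (q-sym {i} j) → x ≡ q i j
      unique u-sym      ()
      unique (p-sym k)  eq = ⊥-elim (<⇒≢ (slice-< {k = 0} {k′ = 2} z<s (rev<n k)) eq)
      unique (pb-sym k) eq = ⊥-elim (<⇒≢ (slice-< {k = 1} {k′ = 2} ≤-refl (rev<n k)) eq)
      unique (q-sym k)  eq = cong (q i) (toℕ-injective (+-cancelˡ-≡ (2 * m) _ _ (suc-injective eq)))
      unique (qb-sym k) eq = ⊥-elim (<⇒≢ (slice-< {k = 2} {k′ = 3} ≤-refl (toℕ<n j)) (sym eq))
      unique υ-sym      eq = ⊥-elim (<⇒≢ (slice-< {k = 2} {k′ = 4} (s≤s (s≤s (s≤s z≤n))) (toℕ<n j)) (sym eq))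

  VarSym-leftSym : ∀ i b j → VarSym i (leftSym {n} {m} (lit i b) j)
  VarSym-leftSym i true  j = p-sym j
  VarSym-leftSym i false j = pb-sym j

  VarSym-rightSym : ∀ i b j → VarSym i (rightSym {n} {m} (lit i b) j)
  VarSym-rightSym i true  j = q-sym j
  VarSym-rightSym i false j = qb-sym j

  leftSym<rightSym : ∀ i b j → rank {n} {m} (leftSym (lit i b) j) < rank (rightSym (lit i b) j)
  leftSym<rightSym i true  j = offset-<⇒rank-< (p-sym {i = i} j) (q-sym {i = i} j) (slice-< {k = 0} {k′ = 2} z<s (rev<n j))
  leftSym<rightSym i false j = offset-<⇒rank-< (pb-sym {i = i} j) (qb-sym {i = i} j) (slice-< {k = 1} {k′ = 3} (s≤s (s≤s z≤n)) (rev<n j))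

  leftSym-injective : ∀ {i b b′} {j : Fin m} → leftSym {n} (lit i b) j ≡ leftSym (lit i b′) j → b ≡ b′
  leftSym-injective {b = true}  {true}  _  = refl
  leftSym-injective {b = false} {false} _  = refl
  leftSym-injective {b = true}  {false} ()
  leftSym-injective {b = false} {true}  ()

  p<pb : ∀ i (j k : Fin m) → rank {n} (p i j) < rank (pb i k)
  p<pb i j k = offset-<⇒rank-< (p-sym {i = i} j) (pb-sym {i = i} k) (slice-< {k = 0} {k′ = 1} z<s (rev<n j))

  pb<q : ∀ i (j k : Fin m) → rank {n} (pb i k) < rank (q i j)
  pb<q i j k = offset-<⇒rank-< (pb-sym {i = i} k) (q-sym {i = i} j) (slice-< {k = 1} {k′ = 2} ≤-refl (rev<n k))

  q<qb : ∀ i (j k : Fin m) → rank {n} (q i j) < rank (qb i k)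
  q<qb i j k = offset-<⇒rank-< (q-sym {i = i} j) (qb-sym {i = i} k) (slice-< {k = 2} {k′ = 3} ≤-refl (toℕ<n j))

-- Red edges between literal symbols

module LiteralEdges {n m : ℕ} (Φ : CNF3 n m) {S} (sch : IsSchedule _≺ˢ_ (perm Φ) S) where
  open Ranked (rank {n} {m})
  open Joined

  π : List (Sym n m)
  π = perm Φ

  LitJoined : Fin n → Fin m → Bool → Set
  LitJoined i j b = Joined π S (leftSym (lit i b) j) (rightSym (lit i b) j)

  literal-joined : ∀ {i j b} → LitRed Φ S i j b → LitJoined i j b
  literal-joined {i} {j} {b} = RedJoin⇒Joined (leftSym<rightSym i b j)

  in-clause-Before : ∀ {x y} {j : Fin m} {a b} → x ∈ π → y ∈ π →
                     position x ≡ (suc (toℕ j) , a) → position y ≡ (suc (toℕ j) , b) → a < b → Before x y π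
  in-clause-Before x∈ y∈ x≡ y≡ a<b = position⇒Before Φ x∈ y∈
    (inj₂ (trans (cong proj₁ x≡) (sym (cong proj₁ y≡)) , subst₂ _<_ (sym (cong proj₂ x≡)) (sym (cong proj₂ y≡)) a<b))

  crossing-literals : ∀ {j i i′ b b′} → toℕ i < toℕ i′ → LitJoined i j b → LitJoined i′ j b′ → ⊥
  crossing-literals {j} {i} {i′} {b} {b′} i<i′ J J′ =
    crossing-joins sch (π-unique Φ) J′ J
      (in-clause-Before (x∈π J′) (x∈π J) (position-leftSym (lit i′ b′) j) (position-leftSym (lit i b) j)
        (s≤s (rev-mono i<i′)))
      (in-clause-Before (x∈π J) (y∈π J′) (position-leftSym (lit i b) j) (position-rightSym (lit i′ b′) j)
        (s≤s (<-≤-trans (rev<n i) (m≤m+n n _))))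
      (in-clause-Before (y∈π J′) (y∈π J) (position-rightSym (lit i′ b′) j) (position-rightSym (lit i b) j)
        (s≤s (+-monoʳ-< n (rev-mono i<i′))))
      (VarSym-< i<i′ (VarSym-leftSym i b j) (VarSym-leftSym i′ b′ j))
      (VarSym-< i<i′ (VarSym-rightSym i b j) (VarSym-rightSym i′ b′ j))

  one-literal-per-clause : ∀ (j : Fin m) (i i′ : Fin n) (b b′ : Bool) →
                           LitRed Φ S i j b → LitRed Φ S i′ j b′ → i ≡ i′ × b ≡ b′
  one-literal-per-clause j i i′ b b′ h h′ with <-cmp (toℕ i) (toℕ i′)
  ... | tri< i<i′ _ _ = ⊥-elim (crossing-literals i<i′ (literal-joined h) (literal-joined h′))
  ... | tri> _ _ i′<i = ⊥-elim (crossing-literals i′<i (literal-joined h′) (literal-joined h))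
  ... | tri≈ _ i≡i′ _ with toℕ-injective i≡i′
  ...   | refl = refl , leftSym-injective (position-injective Φ (x∈π (literal-joined h)) (x∈π (literal-joined h′))
                          (trans (position-leftSym (lit i b) j) (sym (position-leftSym (lit i b′) j))))

  no-opposite-literals : ∀ (i : Fin n) (j k : Fin m) → k ≢ j → LitRed Φ S i j true → ¬ LitRed Φ S i k false
  no-opposite-literals i j k k≢j h h′ =
    overlapping-joins sch (π-unique Φ) J J′ (p<pb i j k) (pb<q i j k) (q<qb i j k)
      (pb-rank-unique i k) (q-rank-unique i j) apart
    where
      J : LitJoined i j true
      J = literal-joined h
      J′ : LitJoined i k false
      J′ = literal-joined h′
      later-clause : ∀ {x y} → x ∈ π → y ∈ π → proj₁ (position x) < proj₁ (position y) → Before x y π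
      later-clause x∈ y∈ x<y = position⇒Before Φ x∈ y∈ (inj₁ x<y)
      apart : Before (q i j) (pb i k) π ⊎ (Before (pb i k) (p i j) π × Before (qb i k) (q i j) π)
      apart with <-cmp (toℕ j) (toℕ k)
      ... | tri< j<k _ _ = inj₁ (later-clause (y∈π J) (x∈π J′) (s≤s j<k))
      ... | tri≈ _ j≡k _ = ⊥-elim (k≢j (sym (toℕ-injective j≡k)))
      ... | tri> _ _ k<j = inj₂ (later-clause (x∈π J′) (x∈π J) (s≤s k<j) , later-clause (y∈π J′) (y∈π J) (s≤s k<j))

  LitRedAt : Fin n × Fin m × Bool → Set
  LitRedAt (i , j , b) = LitRed Φ S i j b

  literal-edges≤m : (L : List (Fin n × Fin m × Bool)) → Unique L → All LitRedAt L → length L ≤ m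
  literal-edges≤m L = Unique-length≤ (λ (_ , j , _) → j) same-clause
    where
      same-clause : ∀ {x y} → LitRedAt x → LitRedAt y → proj₁ (proj₂ x) ≡ proj₁ (proj₂ y) → x ≡ y
      same-clause {i , j , b} {i′ , .j , b′} h h′ refl with one-literal-per-clause j i i′ b b′ h h′
      ... | refl , refl = refl

corollary2 : ∀ (n m : ℕ) (Φ : CNF3 n m) (S : List (List (Sym n m) × List (Sym n m)))
    → IsSchedule _≺ˢ_ (perm Φ) S
    → ((L : List (Fin n × Fin m × Bool)) → Unique L
         → All (λ { (i , j , b) → LitRed Φ S i j b }) L → length L ≤ m)
    × (∀ (j : Fin m) (i i′ : Fin n) (b b′ : Bool)
         → LitRed Φ S i j b → LitRed Φ S i′ j b′ → (i ≡ i′ × b ≡ b′))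
    × (∀ (i : Fin n) (j k : Fin m) → k ≢ j
         → LitRed Φ S i j true → ¬ LitRed Φ S i k false)
corollary2 n m Φ S sch =
  (λ L uq reds → literal-edges≤m L uq (All.map (λ { {_ , _ , _} red → red }) reds)) ,
  one-literal-per-clause ,
  no-opposite-literals
  where open LiteralEdges Φ sch
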